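{- The mapping $\varphi:\Omega_1^{\mathrm{vbl}}\rightarrow \Omega_0\times V\times A$, $\varphi(\sigma,u):=(\sigma_{\mathrm{fix}},v_0, u\rightarrow u')$, is $r_{\max}$-preserving and injective; that is, it is injective and $\mathrm{wt}(\sigma)\le r_{\max}\,\mathrm{wt}(\sigma_{\mathrm{fix}})$ for every $(\sigma,u)\in\Omega_1^{\mathrm{vbl}}$.
   Context: Let $G=(V,E)$ be a connected undirected graph with root $r$ and edge weights $w_e>0$; let $r_{\max}:=\max_{e,e'\in E}w_e/w_{e'}$ and $A=\{u\rightarrow v,\ v\rightarrow u\mid (u,v)\in E\}$. An assignment $\sigma$ assigns to each vertex $v\neq r$ a neighbour $\sigma(v)$, inducing the directed graph with arcs $v\rightarrow\sigma(v)$; its weight is $\mathrm{wt}(\sigma)=\prod_{v\neq r}w_{(v,\sigma(v))}$. Bad events are the presence of directed cycles $C$, with $\mathrm{vbl}(B_C)$ the random arcs of the vertices on $C$. Let $\Omega_0$ be the set of assignments with no cycle (i.e., inducing a spanning tree rooted at $r$), $\Omega_1$ the set with exactly one cycle, and $\Omega_1^{\mathrm{vbl}}=\{(\sigma,u)\mid \sigma\in\Omega_1 \text{ with unique cycle } C,\ u\in C\}$. Fix an ordering of vertices and edges. For $(\sigma,u)\in\Omega_1^{\mathrm{vbl}}$, let $u'=\sigma(u)$. The graph induced by $\sigma$ has two components: a tree containing $r$ and a unicyclic component containing $C$. Let $(v_0,v_1)$ be an edge of $G$ joining them (chosen via the fixed ordering), with $v_0$ in the tree component and $v_1$ in the unicyclic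 component. Following arcs of $\sigma$ from $v_1$ one reaches the cycle and then $u$; let the vertices along this path be $v_1,v_2,\dots,v_\ell=u$. Define $\sigma_{\mathrm{fix}}(v_i)=v_{i-1}$ for $i\in[\ell]$ and $\sigma_{\mathrm{fix}}(v)=\sigma(v)$ otherwise; then $\sigma_{\mathrm{fix}}\in\Omega_0$.
   Formalization: The edge weights $w_e$ and the ratio $r_{\max}$ take rational values. -}

module Defs where

open import Data.Nat using (ℕ; zero; suc; _<ᵇ_)
open import Data.Fin using (Fin; _≟_)
open import Data.Bool using (Bool; true; false; T; if_then_else_)
open import Data.List using (List; foldr; map; allFin)
open import Data.Product using (Σ; ∃; _×_; _,_; proj₁; proj₂)
open import Data.Rational using (ℚ; 0ℚ; 1ℚ; _*_; _≤_; _<_)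
open import Relation.Nullary using (¬_; ⌊_⌋)
open import Relation.Binary.PropositionalEquality using (_≡_; _≢_)

Adj : {n : ℕ} → (Fin n → Fin n → Bool) → Fin n → Fin n → Set
Adj E u v = T (E u v)

data Reach {n : ℕ} (E : Fin n → Fin n → Bool) : Fin n → Fin n → Set where
  here  : ∀ {u} → Reach E u u
  there : ∀ {u v w} → Adj E u v → Reach E v w → Reach E u w

record IsSimpleGraph {n : ℕ} (E : Fin n → Fin n → Bool) : Set where
  field
    symmetric   : ∀ u v → E u v ≡ E v u
    loopless    : ∀ u → ¬ Adj E u u

Connected : {n : ℕ} → (Fin n → Fin n → Bool) → Set
Connected E = ∀ u v → Reach E u v

record IsWeighting {n : ℕ} (E : Fin n → Fin n → Bool) (w : Fin n → Fin n → ℚ) : Set where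
  field
    w-sym : ∀ u v → w u v ≡ w v u
    w-pos : ∀ u v → Adj E u v → 0ℚ < w u v

-- r is r_max = max_{e,e'} w_e / w_e', written without division:
-- r bounds every ratio and is attained by some ratio.
IsRmax : {n : ℕ} → (Fin n → Fin n → Bool) → (Fin n → Fin n → ℚ) → ℚ → Set
IsRmax E w r =
  (∀ a b c d → Adj E a b → Adj E c d → w a b ≤ r * w c d) ×
  (∃ λ a → ∃ λ b → ∃ λ c → ∃ λ d → Adj E a b × Adj E c d × w a b ≡ r * w c d)

-- An assignment is represented by σ : Fin n → Fin n with σ v a neighbour of v
-- for v ≠ r, and the convention σ r = r (the root has no arc).
IsAssignment : {n : ℕ} → (Fin n → Fin n → Bool) → Fin n → (Fin n → Fin n) → Set
IsAssignment E r σ = (σ r ≡ r) × (∀ v → v ≢ r → Adj E v (σ v))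

iter : {n : ℕ} → (Fin n → Fin n) → ℕ → Fin n → Fin n
iter σ zero    v = v
iter σ (suc k) v = σ (iter σ k v)

wt : {n : ℕ} → (Fin n → Fin n → ℚ) → Fin n → (Fin n → Fin n) → ℚ
wt {n} w r σ = foldr _*_ 1ℚ (map f (allFin n))
  where
  f : Fin n → ℚ
  f v = if ⌊ v ≟ r ⌋ then 1ℚ else w v (σ v)

OnCycle : {n : ℕ} → Fin n → (Fin n → Fin n) → Fin n → Set
OnCycle r σ v = (v ≢ r) × ∃ λ k → iter σ (suc k) v ≡ v

InΩ₀ : {n : ℕ} → Fin n → (Fin n → Fin n) → Set
InΩ₀ r σ = ∀ v → ¬ OnCycle r σ v

-- Ω₁ : exactly one directed cycle (some cycle exists, and all cycle
-- vertices lie on one common cycle)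
InΩ₁ : {n : ℕ} → Fin n → (Fin n → Fin n) → Set
InΩ₁ r σ = (∃ λ v → OnCycle r σ v) ×
           (∀ a b → OnCycle r σ a → OnCycle r σ b → ∃ λ k → iter σ k a ≡ b)

InΩ₁vbl : {n : ℕ} → Fin n → (Fin n → Fin n) → Fin n → Set
InΩ₁vbl r σ u = InΩ₁ r σ × OnCycle r σ u

InTreeComp : {n : ℕ} → Fin n → (Fin n → Fin n) → Fin n → Set
InTreeComp r σ v = ∃ λ k → iter σ k v ≡ r

InUnicyclicComp : {n : ℕ} → Fin n → (Fin n → Fin n) → Fin n → Set
InUnicyclicComp r σ v = ∃ λ k → OnCycle r σ (iter σ k v)

IsJoiningEdge : {n : ℕ} → (Fin n → Fin n → Bool) → Fin n → (Fin n → Fin n) →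
                Fin n × Fin n → Set
IsJoiningEdge E r σ (v₀ , v₁) =
  Adj E v₀ v₁ × InTreeComp r σ v₀ × InUnicyclicComp r σ v₁

-- least j < fuel with p j = true, or fuel if none
least : ℕ → (ℕ → Bool) → ℕ
least zero    p = zero
least (suc m) p = if p zero then zero else suc (least m (λ j → p (suc j)))

-- σ_fix, given σ, u and the joining edge (v₀,v₁).  With v_i = σ^{i-1}(v₁),
-- ℓ is the first index with v_ℓ = u; hit = ℓ - 1.
σfix : {n : ℕ} → (Fin n → Fin n) → Fin n → Fin n × Fin n → Fin n → Fin n
σfix {n} σ u (v₀ , v₁) x =
  if j <ᵇ suc hit then back j else σ x
  where
  hit : ℕ
  hit = least n (λ i → ⌊ iter σ i v₁ ≟ u ⌋)
  -- x = v_{j+1} if j ≤ hit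
  j : ℕ
  j = least (suc hit) (λ i → ⌊ iter σ i v₁ ≟ x ⌋)
  -- σ_fix(v_{j+1}) = v_j, with v_0 = v₀
  back : ℕ → Fin n
  back zero    = v₀
  back (suc i) = iter σ i v₁

{-# OPTIONS --safe #-}
module Submission where

-- Write vᵢ₊₁ = σⁱ(v₁), so that v₁, …, v_ℓ = u is the σ-path of the statement; σ_fix sends each vᵢ
-- (1 ≤ i ≤ ℓ) to vᵢ₋₁ and agrees with σ elsewhere. Redirecting these ℓ arcs one at a time changes
-- the weight by w(vᵢ₋₁,vᵢ)/w(vᵢ,vᵢ₊₁) per step; the product telescopes to
-- wt(σ_fix)·w(u,u′) = wt(σ)·w(v₀,v₁), and w(u,u′) ≤ r_max·w(v₀,v₁) gives the weight bound.
-- For injectivity, iterating σ_fix from u walks the path backwards, v_ℓ, …, v₁, v₀, and meets v₀ for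
-- the first time after exactly ℓ steps, because the path lies in the unicyclic component and v₀ does
-- not. So σ_fix, u and v₀ determine ℓ and the path, hence σ on the path; off the path σ = σ_fix,
-- and σ(u) = u′ is recorded.

open import Defs
open import Algebra.Bundles using (CommutativeMonoid)
import Algebra.Properties.CommutativeMonoid.Sum as CommutativeMonoidSum
import Algebra.Properties.CommutativeSemigroup as CommutativeSemigroupProperties
open import Data.Bool using (Bool; true; false; T; if_then_else_)
open import Data.Fin as Fin using (Fin; _≟_; toℕ)
open import Data.Fin.Properties using (pigeonhole; toℕ<n; punchInᵢ≢i)
import Data.List as List
open import Data.List.Properties using (map-tabulate)
open import Data.Nat as ℕ using (ℕ; zero; suc; _+_; _∸_; _<ᵇ_)
open import Data.Product using (∃; _×_; _,_; proj₁; proj₂)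
open import Data.Product.Properties using (,-injectiveˡ; ,-injectiveʳ)
open import Data.Rational using (ℚ; 0ℚ; 1ℚ; _*_; NonNegative; nonNegative; positive)
import Data.Rational.Properties as ℚ
open import Data.Sum using (_⊎_; inj₁; inj₂)
open import Data.Vec.Functional using (Vector; removeAt)
import Data.Vec.Functional as Vector
open import Function using (_∘_; id)
open import Level using (Level)
open import Relation.Binary.PropositionalEquality
  using (_≡_; _≢_; _≗_; refl; sym; trans; cong; cong₂; subst; module ≡-Reasoning)
import Relation.Binary.Reasoning.Setoid as SetoidReasoning
open import Relation.Nullary using (¬_; ⌊_⌋; yes; no; contradiction)
open import Relation.Nullary.Decidable using (toWitness; fromWitness)

-- ℕ's order relations are opened only inside this module, so that outside it _≤_ and _<_ are ℚ's,
-- as in the statement.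
module _ where

  open import Data.Nat using (_≤_; _<_; _<?_; z≤n; s≤s; s≤s⁻¹; z<s)
  open import Data.Nat.Properties
    using (≤-trans; <-trans; <-≤-trans; ≤-<-trans; ≤-antisym; ≮⇒≥; <⇒≤; <⇒<ᵇ; <ᵇ⇒<; n<1+n;
           m<n⇒m<1+n; m≤n⇒m<n∨m≡n; +-suc; +-identityʳ; +-monoʳ-<; m≤m+n; m≤m*n; m∸n+n≡m; m+[n∸m]≡n)

  least-≤-witness : ∀ m P {k} → T (P k) → least m P ≤ k
  least-≤-witness zero    P         _  = z≤n
  least-≤-witness (suc m) P {k}     Pk with P zero in P0
  ... | true  = z≤n
  least-≤-witness (suc m) P {zero}  Pk | false rewrite P0 = contradiction Pk λ ()
  least-≤-witness (suc m) P {suc k} Pk | false = s≤s (least-≤-witness m (P ∘ suc) Pk)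

  least-sound : ∀ m P → least m P < m → T (P (least m P))
  least-sound (suc m) P l<m with P zero in P0
  ... | true  rewrite P0 = _
  ... | false = least-sound m (P ∘ suc) (s≤s⁻¹ l<m)

  least-minimal : ∀ m P {i} → i < least m P → ¬ T (P i)
  least-minimal (suc m) P {i}     i<l with P zero in P0
  least-minimal (suc m) P {zero}  i<l | false rewrite P0 = λ ()
  least-minimal (suc m) P {suc i} i<l | false = least-minimal m (P ∘ suc) (s≤s⁻¹ i<l)

  least-exact : ∀ m P {k} → k < m → T (P k) → (∀ {i} → i < k → ¬ T (P i)) → least m P ≡ k
  least-exact m P k<m Pk first = ≤-antisym (least-≤-witness m P Pk)
    (≮⇒≥ λ l<k → first l<k (least-sound m P (<-trans l<k k<m)))

  module _ {a : Level} {A : Set a} {x y : A} where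

    if-<ᵇ : ∀ {i j} → i < j → (if i <ᵇ j then x else y) ≡ x
    if-<ᵇ {i} {j} i<j with i <ᵇ j | <⇒<ᵇ i<j
    ... | true | _ = refl

    if-≮ᵇ : ∀ {i j} → ¬ i < j → (if i <ᵇ j then x else y) ≡ y
    if-≮ᵇ {i} {j} i≮j with i <ᵇ j in i<ᵇj
    ... | false = refl
    ... | true  = contradiction (<ᵇ⇒< i j (subst T (sym i<ᵇj) _)) i≮j

  module _ {n : ℕ} (σ : Fin n → Fin n) where

    iter-+ : ∀ a b x → iter σ (a + b) x ≡ iter σ a (iter σ b x)
    iter-+ zero    b x = refl
    iter-+ (suc a) b x = cong σ (iter-+ a b x)

    iter-fixed : ∀ {r} → σ r ≡ r → ∀ t → iter σ t r ≡ r
    iter-fixed σr≡r zero    = refl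
    iter-fixed σr≡r (suc t) = trans (cong σ (iter-fixed σr≡r t)) σr≡r

    iter-stays : ∀ {r x i j} → σ r ≡ r → iter σ i x ≡ r → i ≤ j → iter σ j x ≡ r
    iter-stays {r} {x} {i} {j} σr≡r reached i≤j = begin
      iter σ j x                   ≡⟨ cong (λ k → iter σ k x) (m∸n+n≡m i≤j) ⟨
      iter σ ((j ∸ i) + i) x       ≡⟨ iter-+ (j ∸ i) i x ⟩
      iter σ (j ∸ i) (iter σ i x)  ≡⟨ cong (iter σ (j ∸ i)) reached ⟩
      iter σ (j ∸ i) r             ≡⟨ iter-fixed σr≡r (j ∸ i) ⟩
      r                            ∎
      where open ≡-Reasoning

    iter-periodic : ∀ {c m} → iter σ (suc m) c ≡ c → ∀ t → iter σ (t ℕ.* suc m) c ≡ c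
    iter-periodic         cycle zero    = refl
    iter-periodic {c} {m} cycle (suc t) =
      trans (iter-+ (suc m) (t ℕ.* suc m) c) (trans (cong (iter σ (suc m)) (iter-periodic cycle t)) cycle)

  iter-cong : ∀ {n} {σ τ : Fin n → Fin n} → σ ≗ τ → ∀ k x → iter σ k x ≡ iter τ k x
  iter-cong         σ≗τ zero    x = refl
  iter-cong {σ = σ} σ≗τ (suc k) x = trans (cong σ (iter-cong σ≗τ k x)) (σ≗τ _)

  module _ {c ℓ} (M : CommutativeMonoid c ℓ) where
    open CommutativeMonoid M using (Carrier; _≈_; _∙_; ∙-congˡ; ∙-congʳ; setoid; commutativeSemigroup)
      renaming (sym to ≈-sym)
    open CommutativeMonoidSum M using (sum; sum-remove; sum-cong-≋)
    open CommutativeSemigroupProperties commutativeSemigroup using (xy∙z≈zy∙x)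
    open SetoidReasoning setoid

    sum-update : ∀ {n} {f g : Vector Carrier n} x → (∀ {y} → y ≢ x → f y ≈ g y) → sum g ∙ f x ≈ sum f ∙ g x
    sum-update {suc n} {f} {g} x agree = begin
      sum g ∙ f x
        ≈⟨ ∙-congʳ (sum-remove {i = x} g) ⟩
      (g x ∙ sum (removeAt g x)) ∙ f x
        ≈⟨ ∙-congʳ (∙-congˡ (sum-cong-≋ λ j → ≈-sym (agree (punchInᵢ≢i x j)))) ⟩
      (g x ∙ sum (removeAt f x)) ∙ f x
        ≈⟨ xy∙z≈zy∙x (g x) _ (f x) ⟩
      (f x ∙ sum (removeAt f x)) ∙ g x
        ≈⟨ ∙-congʳ (sum-remove {i = x} f) ⟨
      sum f ∙ g x
        ∎

  foldr-tabulate : ∀ {a b} {A : Set a} {B : Set b} (_∙_ : A → B → B) e {n} (f : Vector A n) →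
                   List.foldr _∙_ e (List.tabulate f) ≡ Vector.foldr _∙_ e f
  foldr-tabulate _∙_ e {zero}  f = refl
  foldr-tabulate _∙_ e {suc n} f = cong (f Fin.zero ∙_) (foldr-tabulate _∙_ e (f ∘ Fin.suc))

  ∏ : ∀ {n} → Vector ℚ n → ℚ
  ∏ = CommutativeMonoidSum.sum ℚ.*-1-commutativeMonoid

  arcWeight : ∀ {n} → (Fin n → Fin n → ℚ) → Fin n → (Fin n → Fin n) → Vector ℚ n
  arcWeight w r σ v = if ⌊ v ≟ r ⌋ then 1ℚ else w v (σ v)

  module _ {n : ℕ} (w : Fin n → Fin n → ℚ) (r : Fin n) where

    wt≡∏ : ∀ σ → wt w r σ ≡ ∏ (arcWeight w r σ)
    wt≡∏ σ = trans (cong (List.foldr _*_ 1ℚ) (map-tabulate id (arcWeight w r σ)))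
                   (foldr-tabulate _*_ 1ℚ (arcWeight w r σ))

    arcWeight-off-root : ∀ σ {v} → v ≢ r → arcWeight w r σ v ≡ w v (σ v)
    arcWeight-off-root σ {v} v≢r with v ≟ r
    ... | yes v≡r = contradiction v≡r v≢r
    ... | no  _   = refl

    arcWeight-cong : ∀ {σ τ v} → σ v ≡ τ v → arcWeight w r σ v ≡ arcWeight w r τ v
    arcWeight-cong {v = v} = cong (λ z → if ⌊ v ≟ r ⌋ then 1ℚ else w v z)

    wt-cong : ∀ {σ τ} → σ ≗ τ → wt w r σ ≡ wt w r τ
    wt-cong {σ} {τ} σ≗τ = trans (wt≡∏ σ)
      (trans (CommutativeMonoidSum.sum-cong-≗ ℚ.*-1-commutativeMonoid (λ v → arcWeight-cong {σ} {τ} (σ≗τ v)))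
             (sym (wt≡∏ τ)))

    wt-update : ∀ {σ τ x} → x ≢ r → (∀ {y} → y ≢ x → σ y ≡ τ y) →
                wt w r τ * w x (σ x) ≡ wt w r σ * w x (τ x)
    wt-update {σ} {τ} {x} x≢r agree = begin
      wt w r τ * w x (σ x)
        ≡⟨ cong₂ _*_ (wt≡∏ τ) (sym (arcWeight-off-root σ x≢r)) ⟩
      ∏ (arcWeight w r τ) * arcWeight w r σ x
        ≡⟨ sum-update ℚ.*-1-commutativeMonoid x (λ y≢x → arcWeight-cong {σ} {τ} (agree y≢x)) ⟩
      ∏ (arcWeight w r σ) * arcWeight w r τ x
        ≡⟨ cong₂ _*_ (sym (wt≡∏ σ)) (arcWeight-off-root τ x≢r) ⟩
      wt w r σ * w x (τ x)
        ∎
      where open ≡-Reasoning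

  module Orbit {n : ℕ} (σ : Fin n → Fin n) (x : Fin n) where

    orbit : ℕ → Fin n
    orbit i = iter σ i x

    FirstVisit : ℕ → Set
    FirstVisit k = ∀ {i} → i < k → orbit i ≢ orbit k

    DistinctBelow : ℕ → Set
    DistinctBelow m = ∀ {k} → k < m → FirstVisit k

    first-visit-distinct : ∀ {h} → FirstVisit h → DistinctBelow (suc h)
    first-visit-distinct {h} first {j} j<1+h {i} i<j orbit-i≡orbit-j = first shifted-i<h shifted-i-visits
      where
      d : ℕ
      d = h ∸ j
      d+j≡h : d + j ≡ h
      d+j≡h = m∸n+n≡m (s≤s⁻¹ j<1+h)
      shifted-i<h : d + i < h
      shifted-i<h = subst (d + i <_) d+j≡h (+-monoʳ-< d i<j)
      shifted-i-visits : orbit (d + i) ≡ orbit h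
      shifted-i-visits = begin
        orbit (d + i)       ≡⟨ iter-+ σ d i x ⟩
        iter σ d (orbit i)  ≡⟨ cong (iter σ d) orbit-i≡orbit-j ⟩
        iter σ d (orbit j)  ≡⟨ iter-+ σ d j x ⟨
        orbit (d + j)       ≡⟨ cong orbit d+j≡h ⟩
        orbit h             ∎
        where open ≡-Reasoning

    distinct-below-≤ : ∀ {m} → DistinctBelow m → m ≤ n
    distinct-below-≤ distinct = ≮⇒≥ λ n<m →
      let i , j , i<j , collide = pigeonhole (n<1+n n) (orbit ∘ toℕ)
      in distinct (<-≤-trans (toℕ<n j) n<m) i<j collide

    firstHit : Fin n → ℕ
    firstHit y = least n (λ i → ⌊ orbit i ≟ y ⌋)

    firstHit-spec : ∀ {y k} → orbit k ≡ y → orbit (firstHit y) ≡ y × DistinctBelow (suc (firstHit y))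
    firstHit-spec {y} {k} reached =
      subst (λ h → orbit h ≡ y × DistinctBelow (suc h)) (sym firstHit≡h) (hit , distinct)
      where
      P : ℕ → Bool
      P i = ⌊ orbit i ≟ y ⌋
      h : ℕ
      h = least (suc k) P
      hit : orbit h ≡ y
      hit = toWitness (least-sound (suc k) P (s≤s (least-≤-witness (suc k) P (fromWitness reached))))
      before : ∀ {i} → i < h → orbit i ≢ y
      before i<h = least-minimal (suc k) P i<h ∘ fromWitness
      distinct : DistinctBelow (suc h)
      distinct = first-visit-distinct λ i<h e → before i<h (trans e hit)
      firstHit≡h : firstHit y ≡ h
      firstHit≡h = least-exact n P (distinct-below-≤ distinct) (fromWitness hit)
                               (λ i<h → before i<h ∘ toWitness)

  -- path i is the vᵢ₊₁ of the statement and back i its vᵢ, so reroute m redirects v₁, …, v_m;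
  -- σ_fix is reroute ℓ (σfix≗reroute).
  module Rerouting {n : ℕ} (σ : Fin n → Fin n) (v₀ v₁ : Fin n) where

    open Orbit σ v₁ public renaming (orbit to path)

    back : ℕ → Fin n
    back zero    = v₀
    back (suc i) = path i

    index : ℕ → Fin n → ℕ
    index m x = least m (λ i → ⌊ path i ≟ x ⌋)

    reroute : ℕ → Fin n → Fin n
    reroute m x = if index m x <ᵇ m then back (index m x) else σ x

    path-view : ∀ m x → (∃ λ k → k < m × FirstVisit k × path k ≡ x) ⊎ (∀ {k} → k < m → path k ≢ x)
    path-view m x with index m x <? m
    ... | no  i≮m = inj₂ λ k<m hit → i≮m (≤-<-trans (least-≤-witness m _ (fromWitness hit)) k<m)
    ... | yes i<m = inj₁ (index m x , i<m , first , hit)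
      where
      hit : path (index m x) ≡ x
      hit = toWitness (least-sound m _ i<m)
      first : FirstVisit (index m x)
      first i<index e = least-minimal m _ i<index (fromWitness (trans e hit))

    reroute-on-path : ∀ {m k} → k < m → FirstVisit k → reroute m (path k) ≡ back k
    reroute-on-path {m} {k} k<m first =
      trans (cong (λ j → if j <ᵇ m then back j else σ (path k)) index-path) (if-<ᵇ k<m)
      where
      index-path : index m (path k) ≡ k
      index-path = least-exact m _ k<m (fromWitness refl) (λ i<k → first i<k ∘ toWitness)

    reroute-off-path : ∀ {m x} → (∀ {k} → k < m → path k ≢ x) → reroute m x ≡ σ x
    reroute-off-path {m} off = if-≮ᵇ λ i<m → off i<m (toWitness (least-sound m _ i<m))

    reroute-suc : ∀ {k x} → x ≢ path k → reroute (suc k) x ≡ reroute k x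
    reroute-suc {k} {x} x≢path-k with path-view k x
    ... | inj₁ (j , j<k , first , refl) =
      trans (reroute-on-path (m<n⇒m<1+n j<k) first) (sym (reroute-on-path j<k first))
    ... | inj₂ off = trans (reroute-off-path off′) (sym (reroute-off-path off))
      where
      off′ : ∀ {j} → j < suc k → path j ≢ x
      off′ j<1+k with m≤n⇒m<n∨m≡n (s≤s⁻¹ j<1+k)
      ... | inj₁ j<k  = off j<k
      ... | inj₂ refl = x≢path-k ∘ sym

    module _ (w : Fin n → Fin n → ℚ) (w-sym : ∀ a b → w a b ≡ w b a)
             {r : Fin n} (avoids-r : ∀ i → path i ≢ r) where

      wt-reroute-suc : ∀ {k} → FirstVisit k →
                       wt w r (reroute (suc k)) * w (path k) (path (suc k))
                         ≡ wt w r (reroute k) * w (back k) (path k)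
      wt-reroute-suc {k} first = begin
        wt w r (reroute (suc k)) * w (path k) (path (suc k))
          ≡⟨ cong (λ y → wt w r (reroute (suc k)) * w (path k) y) (reroute-off-path first) ⟨
        wt w r (reroute (suc k)) * w (path k) (reroute k (path k))
          ≡⟨ wt-update w r (avoids-r k) (sym ∘ reroute-suc) ⟩
        wt w r (reroute k) * w (path k) (reroute (suc k) (path k))
          ≡⟨ cong (λ y → wt w r (reroute k) * w (path k) y) (reroute-on-path (n<1+n k) first) ⟩
        wt w r (reroute k) * w (path k) (back k)
          ≡⟨ cong (wt w r (reroute k) *_) (w-sym (path k) (back k)) ⟩
        wt w r (reroute k) * w (back k) (path k)
          ∎
        where open ≡-Reasoning

      wt-reroute : ∀ {k} → DistinctBelow k → wt w r (reroute k) * w (back k) (path k) ≡ wt w r σ * w v₀ v₁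
      wt-reroute {zero}  _        = refl   -- reroute 0 computes to σ
      wt-reroute {suc k} distinct =
        trans (wt-reroute-suc (distinct (n<1+n k))) (wt-reroute (distinct ∘ m<n⇒m<1+n))

    record IsSimplePathTo (u : Fin n) (h : ℕ) : Set where
      field
        ends-at   : path h ≡ u
        distinct  : DistinctBelow (suc h)
        avoids-v₀ : ∀ i → path i ≢ v₀

    module _ {u h} (P : IsSimplePathTo u h) where
      open IsSimplePathTo P

      reroute-walk : ∀ {i d} → i + d ≡ h → iter (reroute (suc h)) d u ≡ path i
      reroute-walk {i} {zero}  i+0≡h   = sym (trans (cong path (trans (sym (+-identityʳ i)) i+0≡h)) ends-at)
      reroute-walk {i} {suc d} i+1+d≡h = trans (cong (reroute (suc h)) (reroute-walk {suc i} {d} 1+i+d≡h))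
                                               (reroute-on-path (s≤s 1+i≤h) (distinct (s≤s 1+i≤h)))
        where
        1+i+d≡h : suc i + d ≡ h
        1+i+d≡h = trans (sym (+-suc i d)) i+1+d≡h
        1+i≤h : suc i ≤ h
        1+i≤h = subst (suc i ≤_) 1+i+d≡h (m≤m+n (suc i) d)

      reroute-walk-end : iter (reroute (suc h)) (suc h) u ≡ v₀
      reroute-walk-end = trans (cong (reroute (suc h)) (reroute-walk {0} {h} refl)) (reroute-on-path z<s λ ())

      reroute-walk-avoids-v₀ : ∀ {d} → d ≤ h → iter (reroute (suc h)) d u ≢ v₀
      reroute-walk-avoids-v₀ {d} d≤h =
        avoids-v₀ (h ∸ d) ∘ trans (sym (reroute-walk {h ∸ d} {d} (m∸n+n≡m d≤h)))

      path-by-reroute-walk : ∀ {k} → k ≤ h → path k ≡ iter (reroute (suc h)) (h ∸ k) u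
      path-by-reroute-walk {k} k≤h = sym (reroute-walk {k} {h ∸ k} (m+[n∸m]≡n k≤h))

  module _ {n : ℕ} {σ τ : Fin n → Fin n} {v₀ v₁ v₁′ u : Fin n} where
    private
      module S = Rerouting σ v₀ v₁
      module T = Rerouting τ v₀ v₁′

    simple-path-length-unique : ∀ {h h′} → S.IsSimplePathTo u h → T.IsSimplePathTo u h′ →
                                S.reroute (suc h) ≗ T.reroute (suc h′) → h ≡ h′
    simple-path-length-unique {h} {h′} P Q F≗F′ = ≤-antisym
      (≮⇒≥ λ h′<h → S.reroute-walk-avoids-v₀ P h′<h
                      (trans (iter-cong F≗F′ (suc h′) u) (T.reroute-walk-end Q)))
      (≮⇒≥ λ h<h′ → T.reroute-walk-avoids-v₀ Q h<h′
                      (trans (sym (iter-cong F≗F′ (suc h) u)) (S.reroute-walk-end P)))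

    simple-paths-agree : ∀ {h} → S.IsSimplePathTo u h → T.IsSimplePathTo u h →
                         S.reroute (suc h) ≗ T.reroute (suc h) → ∀ {k} → k ≤ h → S.path k ≡ T.path k
    simple-paths-agree {h} P Q F≗F′ {k} k≤h = begin
      S.path k                            ≡⟨ S.path-by-reroute-walk P k≤h ⟩
      iter (S.reroute (suc h)) (h ∸ k) u  ≡⟨ iter-cong F≗F′ (h ∸ k) u ⟩
      iter (T.reroute (suc h)) (h ∸ k) u  ≡⟨ T.path-by-reroute-walk Q k≤h ⟨
      T.path k                            ∎
      where open ≡-Reasoning

    reroute-injective : ∀ {h h′} → S.IsSimplePathTo u h → T.IsSimplePathTo u h′ → σ u ≡ τ u →
                        S.reroute (suc h) ≗ T.reroute (suc h′) → σ ≗ τ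
    reroute-injective {h} P Q σu≡τu F≗F′ x
      with refl ← simple-path-length-unique P Q F≗F′
      with S.path-view (suc h) x
    ... | inj₂ off-S = begin
      σ x                  ≡⟨ S.reroute-off-path off-S ⟨
      S.reroute (suc h) x  ≡⟨ F≗F′ x ⟩
      T.reroute (suc h) x  ≡⟨ T.reroute-off-path off-T ⟩
      τ x                  ∎
      where
      open ≡-Reasoning
      off-T : ∀ {k} → k < suc h → T.path k ≢ x
      off-T k<1+h = off-S k<1+h ∘ trans (simple-paths-agree P Q F≗F′ (s≤s⁻¹ k<1+h))
    ... | inj₁ (k , k<1+h , _ , refl) with m≤n⇒m<n∨m≡n (s≤s⁻¹ k<1+h)
    ...   | inj₂ refl = subst (λ y → σ y ≡ τ y) (sym (S.IsSimplePathTo.ends-at P)) σu≡τu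
    ...   | inj₁ k<h  = begin
      σ (S.path k)  ≡⟨ simple-paths-agree P Q F≗F′ k<h ⟩
      τ (T.path k)  ≡⟨ cong τ (simple-paths-agree P Q F≗F′ (<⇒≤ k<h)) ⟨
      τ (S.path k)  ∎
      where open ≡-Reasoning

  module _ {n : ℕ} {r : Fin n} {σ : Fin n → Fin n} (σr≡r : σ r ≡ r) where

    -- The orbit is back at the cycle vertex c at every multiple of the period after k, in
    -- particular after it has reached the fixed point r.
    unicyclic-avoids-root : ∀ {x} → InUnicyclicComp r σ x → ∀ i → iter σ i x ≢ r
    unicyclic-avoids-root {x} (k , c≢r , m , cycle) i reached = c≢r (begin
      c                           ≡⟨ iter-periodic σ cycle i ⟨
      iter σ (i ℕ.* suc m) c      ≡⟨ iter-+ σ (i ℕ.* suc m) k x ⟨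
      iter σ (i ℕ.* suc m + k) x  ≡⟨ iter-stays σ σr≡r reached (≤-trans (m≤m*n i (suc m)) (m≤m+n _ k)) ⟩
      r                           ∎)
      where
      open ≡-Reasoning
      c : Fin n
      c = iter σ k x

    Ω₁-simple-path : ∀ {u v₀ v₁} → InΩ₁vbl r σ u → InTreeComp r σ v₀ → InUnicyclicComp r σ v₁ →
                     Rerouting.IsSimplePathTo σ v₀ v₁ u (Orbit.firstHit σ v₁ u)
    Ω₁-simple-path {u} {v₀} {v₁} ((_ , cycle-connected) , u-on-cycle) (k₀ , v₀-reaches-r)
                   v₁-unicyclic@(k , c-on-cycle) =
      record { ends-at = proj₁ spec ; distinct = proj₂ spec ; avoids-v₀ = avoids-v₀ }
      where
      open Rerouting σ v₀ v₁
      cycle-reaches-u : ∃ λ k′ → iter σ k′ (path k) ≡ u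
      cycle-reaches-u = cycle-connected (path k) u c-on-cycle u-on-cycle
      reaches-u : path (proj₁ cycle-reaches-u + k) ≡ u
      reaches-u = trans (iter-+ σ (proj₁ cycle-reaches-u) k v₁) (proj₂ cycle-reaches-u)
      spec : path (firstHit u) ≡ u × DistinctBelow (suc (firstHit u))
      spec = firstHit-spec {k = proj₁ cycle-reaches-u + k} reaches-u
      avoids-v₀ : ∀ i → path i ≢ v₀
      avoids-v₀ i path-i≡v₀ = unicyclic-avoids-root v₁-unicyclic (k₀ + i)
        (trans (iter-+ σ k₀ i v₁) (trans (cong (iter σ k₀) path-i≡v₀) v₀-reaches-r))

  σfix≗reroute : ∀ {n} (σ : Fin n → Fin n) u v₀ v₁ →
                 σfix σ u (v₀ , v₁) ≗ Rerouting.reroute σ v₀ v₁ (suc (Orbit.firstHit σ v₁ u))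
  σfix≗reroute σ u v₀ v₁ x with Rerouting.index σ v₀ v₁ (suc (Orbit.firstHit σ v₁ u)) x
  ... | zero  = refl
  ... | suc _ = refl

σfix-injective : ∀ {n} {E : Fin n → Fin n → Bool} {r} {σ τ : Fin n → Fin n} {u t} {e e′ : Fin n × Fin n} →
                 IsAssignment E r σ → InΩ₁vbl r σ u → IsJoiningEdge E r σ e →
                 IsAssignment E r τ → InΩ₁vbl r τ t → IsJoiningEdge E r τ e′ →
                 (∀ x → σfix σ u e x ≡ σfix τ t e′ x) → proj₁ e ≡ proj₁ e′ → (u , σ u) ≡ (t , τ t) →
                 (∀ x → σ x ≡ τ x) × u ≡ t
σfix-injective {σ = σ} {τ} {u} {e = v₀ , v₁} {.v₀ , v₁′}
               (σr≡r , _) σ-vbl (_ , σ-tree , σ-unicyclic) (τr≡r , _) τ-vbl (_ , τ-tree , τ-unicyclic)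
               fix≗ refl pair≡
  with refl ← ,-injectiveˡ pair≡ =
  reroute-injective (Ω₁-simple-path σr≡r σ-vbl σ-tree σ-unicyclic)
                    (Ω₁-simple-path τr≡r τ-vbl τ-tree τ-unicyclic)
                    (,-injectiveʳ pair≡)
                    (λ x → trans (sym (σfix≗reroute σ u v₀ v₁ x))
                                 (trans (fix≗ x) (σfix≗reroute τ u v₀ v₁′ x)))
  , refl

σfix-weight-balance : ∀ {n} {E : Fin n → Fin n → Bool} {r w} {σ : Fin n → Fin n} {u v₀ v₁} →
                      IsWeighting E w → IsAssignment E r σ → InΩ₁vbl r σ u → IsJoiningEdge E r σ (v₀ , v₁) →
                      wt w r (σfix σ u (v₀ , v₁)) * w u (σ u) ≡ wt w r σ * w v₀ v₁
σfix-weight-balance {r = r} {w} {σ} {u} {v₀} {v₁} weighting (σr≡r , _) vbl (_ , tree , unicyclic) = begin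
  wt w r (σfix σ u (v₀ , v₁)) * w u (σ u)
    ≡⟨ cong (_* w u (σ u)) (wt-cong w r (σfix≗reroute σ u v₀ v₁)) ⟩
  wt w r (reroute (suc h)) * w u (σ u)
    ≡⟨ cong (λ y → wt w r (reroute (suc h)) * w y (σ y)) ends-at ⟨
  wt w r (reroute (suc h)) * w (path h) (σ (path h))
    ≡⟨ wt-reroute w (IsWeighting.w-sym weighting) (unicyclic-avoids-root σr≡r unicyclic) distinct ⟩
  wt w r σ * w v₀ v₁
    ∎
  where
  open ≡-Reasoning
  open Rerouting σ v₀ v₁
  h : ℕ
  h = firstHit u
  open IsSimplePathTo (Ω₁-simple-path σr≡r vbl tree unicyclic)

open import Data.Rational using (_≤_; _<_)

∏-nonNeg : ∀ {n} {f : Vector ℚ n} → (∀ v → 0ℚ ≤ f v) → 0ℚ ≤ ∏ f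
∏-nonNeg {zero}      _   = ℚ.nonNegative⁻¹ 1ℚ
∏-nonNeg {suc n} {f} f≥0 =
  ℚ.nonNegative⁻¹ _ {{ℚ.nonNeg*nonNeg⇒nonNeg (f Fin.zero) {{head≥0}} (∏ (f ∘ Fin.suc)) {{tail≥0}}}}
  where
  head≥0 : NonNegative (f Fin.zero)
  head≥0 = nonNegative (f≥0 Fin.zero)
  tail≥0 : NonNegative (∏ (f ∘ Fin.suc))
  tail≥0 = nonNegative (∏-nonNeg (f≥0 ∘ Fin.suc))

wt-nonNeg : ∀ {n E r w} {σ : Fin n → Fin n} → IsWeighting E w → IsAssignment E r σ → 0ℚ ≤ wt w r σ
wt-nonNeg {r = r} {w} {σ} weighting (_ , arcs) = subst (0ℚ ≤_) (sym (wt≡∏ w r σ)) (∏-nonNeg arcWeight≥0)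
  where
  arcWeight≥0 : ∀ v → 0ℚ ≤ arcWeight w r σ v
  arcWeight≥0 v with v ≟ r
  ... | yes _   = ℚ.nonNegative⁻¹ 1ℚ
  ... | no  v≢r = ℚ.<⇒≤ (IsWeighting.w-pos weighting v (σ v) (arcs v v≢r))

balanced-ratio-≤ : ∀ {A B a c R} → 0ℚ ≤ A → 0ℚ < a → 0ℚ < c → B * a ≡ A * c → a ≤ R * c → A ≤ R * B
balanced-ratio-≤ {A} {B} {a} {c} {R} A≥0 a>0 c>0 balance a≤Rc = ℚ.*-cancelʳ-≤-pos c {{positive c>0}} (begin
  A * c        ≡⟨ balance ⟨
  B * a        ≤⟨ ℚ.*-monoˡ-≤-nonNeg B {{nonNegative B≥0}} a≤Rc ⟩
  B * (R * c)  ≡⟨ ℚ.*-assoc B R c ⟨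
  B * R * c    ≡⟨ cong (_* c) (ℚ.*-comm B R) ⟩
  R * B * c    ∎)
  where
  open ℚ.≤-Reasoning
  B≥0 : 0ℚ ≤ B
  B≥0 = ℚ.*-cancelʳ-≤-pos a {{positive a>0}} (begin
    0ℚ * a  ≡⟨ ℚ.*-zeroˡ a ⟩
    0ℚ      ≡⟨ ℚ.*-zeroˡ c ⟨
    0ℚ * c  ≤⟨ ℚ.*-monoʳ-≤-nonNeg c {{ℚ.pos⇒nonNeg c {{positive c>0}}}} A≥0 ⟩
    A * c   ≡⟨ balance ⟨
    B * a   ∎)

σfix-weight-bound : ∀ {n} {E : Fin n → Fin n → Bool} {r w rmax} {σ : Fin n → Fin n} {u v₀ v₁} →
                    IsWeighting E w → IsRmax E w rmax →
                    IsAssignment E r σ → InΩ₁vbl r σ u → IsJoiningEdge E r σ (v₀ , v₁) →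
                    wt w r σ ≤ rmax * wt w r (σfix σ u (v₀ , v₁))
σfix-weight-bound {E = E} {r} {w} {rmax} {σ} {u} {v₀} {v₁} weighting (rmax-bound , _) assignment vbl joining =
  balanced-ratio-≤ {B = wt w r (σfix σ u (v₀ , v₁))} {R = rmax}
    (wt-nonNeg weighting assignment)
    (IsWeighting.w-pos weighting u (σ u) u-arc)
    (IsWeighting.w-pos weighting v₀ v₁ (proj₁ joining))
    (σfix-weight-balance weighting assignment vbl joining)
    (rmax-bound u (σ u) v₀ v₁ u-arc (proj₁ joining))
  where
  u-arc : Adj E u (σ u)
  u-arc = proj₂ assignment u (proj₁ (proj₂ vbl))

lemma4p1 :
    (n : ℕ) (E : Fin n → Fin n → Bool) (r : Fin n) (w : Fin n → Fin n → ℚ) (rmax : ℚ) →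
    IsSimpleGraph E → Connected E → IsWeighting E w → IsRmax E w rmax →
    (sel : (Fin n → Fin n) → Fin n × Fin n) →
    (∀ σ → IsAssignment E r σ → InΩ₁ r σ → IsJoiningEdge E r σ (sel σ)) →
    ((∀ σ τ u t →
        IsAssignment E r σ → InΩ₁vbl r σ u →
        IsAssignment E r τ → InΩ₁vbl r τ t →
        (∀ x → σfix σ u (sel σ) x ≡ σfix τ t (sel τ) x) →
        proj₁ (sel σ) ≡ proj₁ (sel τ) →
        (u , σ u) ≡ (t , τ t) →
        (∀ x → σ x ≡ τ x) × u ≡ t) ×
     (∀ σ u → IsAssignment E r σ → InΩ₁vbl r σ u →
        wt w r σ ≤ rmax * wt w r (σfix σ u (sel σ))))
lemma4p1 n E r w rmax _ _ weighting rmax-bound sel sel-joins =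
  (λ σ τ u t σ-assignment σ-vbl τ-assignment τ-vbl →
     σfix-injective {E = E} σ-assignment σ-vbl (sel-joins σ σ-assignment (proj₁ σ-vbl))
                    τ-assignment τ-vbl (sel-joins τ τ-assignment (proj₁ τ-vbl))) ,
  (λ σ u assignment vbl →
     σfix-weight-bound {E = E} {rmax = rmax} weighting rmax-bound assignment vbl
                       (sel-joins σ assignment (proj₁ vbl)))
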